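{- For every integer $t\ge 2$ we have $m(2t,2;2^{t-1})\le 3\cdot(2^t-1)$.
   Context: A linear $[n,k]_q$-code is a $k$-dimensional subspace of $\mathbb{F}_q^n$. The support of $c\in\mathbb{F}_q^n$ is $\operatorname{supp}(c)=\{i: c_i\neq 0\}$. A non-zero codeword $c$ of a linear code $C$ is minimal if no non-zero codeword $u\in C$ has $\operatorname{supp}(u)\subsetneq\operatorname{supp}(c)$; $C$ is a minimal code if all its non-zero codewords are minimal. A linear code is $\Delta$-divisible if the Hamming weights of all its codewords are divisible by $\Delta$. For positive integers $k,\Delta$, $m(k,q;\Delta)$ denotes the minimum length $n$ of a $\Delta$-divisible minimal $[n,k]_q$-code. -}

module Defs where

open import Data.Bool using (Bool; true; false; _xor_; _∧_)
open import Data.Fin using (Fin; zero; suc)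
open import Data.Nat using (ℕ; zero; suc; _+_)
open import Data.Nat.Divisibility using (_∣_)
open import Data.Product using (Σ; _×_; ∃)
open import Relation.Binary.PropositionalEquality using (_≡_)
open import Relation.Nullary using (¬_)

-- Vectors in 𝔽₂ⁿ: 𝔽₂ is modelled by Bool (false = 0, true = 1, xor = +, ∧ = ·).
Word : ℕ → Set
Word n = Fin n → Bool

zeroW : ∀ {n} → Word n
zeroW _ = false

_⊕_ : ∀ {n} → Word n → Word n → Word n
(u ⊕ v) i = u i xor v i

_·_ : ∀ {n} → Bool → Word n → Word n
(a · v) i = a ∧ v i

lincomb : ∀ {k n} → (Fin k → Word n) → (Fin k → Bool) → Word n
lincomb {zero}  G a = zeroW
lincomb {suc k} G a = (a zero · G zero) ⊕ lincomb (λ j → G (suc j)) (λ j → a (suc j))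

bit : Bool → ℕ
bit true  = 1
bit false = 0

wt : ∀ {n} → Word n → ℕ
wt {zero}  w = 0
wt {suc n} w = bit (w zero) + wt (λ i → w (suc i))

NonZero : ∀ {n} → Word n → Set
NonZero w = ∃ λ i → w i ≡ true

StrictSuppSub : ∀ {n} → Word n → Word n → Set
StrictSuppSub u c = (∀ i → u i ≡ true → c i ≡ true) × (∃ λ i → c i ≡ true × u i ≡ false)

-- A linear [n,k]_2 code is given by a generator matrix G whose k rows are
-- linearly independent; the code is {lincomb G a | a ∈ 𝔽₂ᵏ}, of dimension k.
LinIndep : ∀ {k n} → (Fin k → Word n) → Set
LinIndep G = ∀ a → (∀ i → lincomb G a i ≡ false) → ∀ j → a j ≡ false

Divisible : ∀ {k n} → ℕ → (Fin k → Word n) → Set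
Divisible Δ G = ∀ a → Δ ∣ wt (lincomb G a)

Minimal : ∀ {k n} → (Fin k → Word n) → Set
Minimal G = ∀ a b → NonZero (lincomb G a) → NonZero (lincomb G b) →
            ¬ StrictSuppSub (lincomb G b) (lincomb G a)

DivMinCode : (n k Δ : ℕ) → Set
DivMinCode n k Δ = Σ (Fin k → Word n) λ G → LinIndep G × Divisible Δ G × Minimal G

{-# OPTIONS --safe #-}
-- For a nonzero a ∈ 𝔽₂ᵗ the functional v ↦ a·v is 1 on exactly half of 𝔽₂ᵗ, so the
-- simplex code, whose columns are the 2ᵗ − 1 nonzero vectors of 𝔽₂ᵗ, has all nonzero
-- weights equal to H = 2ᵗ⁻¹. Taking the columns (v,0), (0,v), (v,v) instead gives a
-- [3(2ᵗ − 1), 2t] code in which the message (x,y) has weight w(x) + w(y) + w(x+y),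
-- w being the weight in the simplex code.
-- When (x,y) ≠ 0 at least two of x, y, x+y are nonzero, so every nonzero weight is
-- 2H or 3H: the code is H-divisible, and it is minimal because its largest weight is
-- below twice its smallest one (supp u ⊊ supp c would give wt c = wt u + wt (c+u) ≥ 4H).
module Submission where

open import Defs
open import Data.Nat using (ℕ; _≤_; _*_; _^_; _∸_)
open import Data.Product using (Σ; _×_)

open import Algebra using (CommutativeRing)
import Algebra.Properties.CommutativeSemigroup as CommutativeSemigroupProperties
open import Data.Bool using (Bool; true; false; not; _xor_; _∧_; _≟_)
open import Data.Bool.Properties
  using (∧-zeroʳ; ∧-identityʳ; ∧-distribʳ-xor; xor-assoc; xor-identityʳ; ¬-not; xor-∧-commutativeRing)
open import Data.Fin using (Fin; zero; suc; splitAt)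
open import Data.Fin.Properties using (any?; splitAt⁻¹-↑ˡ; splitAt⁻¹-↑ʳ)
open import Data.Nat using (zero; suc; _+_; _<_; z≤n)
open import Data.Nat.Divisibility using (_∣_; ∣-refl; _∣0; ∣m∣n⇒∣m+n)
open import Data.Nat.Properties
  using ( +-assoc; +-identityʳ; +-commutativeSemigroup; +-mono-≤; +-monoʳ-≤; m≤m+n; m≤n+m
        ; m<n+m; m+n≡0⇒m≡0; m+n≡0⇒n≡0; <⇒≱; >⇒≢; m^n>0; ≤-refl; ≤-reflexive; module ≤-Reasoning)
open import Data.Product using (_,_)
open import Data.Sum using (_⊎_; inj₁; inj₂)
open import Data.Vec.Functional using (Vector; _∷_; _++_; tail; take; drop; transpose)
open import Function using (_∘_)
open import Relation.Binary.PropositionalEquality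
  using (_≡_; refl; sym; trans; cong; cong₂; subst; _≗_; module ≡-Reasoning)
open import Relation.Nullary using (yes; no; contradiction)

open CommutativeSemigroupProperties +-commutativeSemigroup
  using () renaming (interchange to +-interchange)
open CommutativeSemigroupProperties (CommutativeRing.+-commutativeSemigroup xor-∧-commutativeRing)
  using () renaming (interchange to xor-interchange)

Zero : ∀ {n} → Word n → Set
Zero w = ∀ i → w i ≡ false

zero-or-nonZero : ∀ {n} (w : Word n) → Zero w ⊎ NonZero w
zero-or-nonZero w with any? (λ i → w i ≟ true)
... | yes w≢0 = inj₂ w≢0
... | no  w≢0 = inj₁ (λ i → ¬-not (λ wᵢ≡true → w≢0 (i , wᵢ≡true)))

nonZero-⊕ : ∀ {n} {u v : Word n} → NonZero u → NonZero v ⊎ NonZero (u ⊕ v)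
nonZero-⊕ {v = v} (i , uᵢ≡true) with v i in vᵢ
... | true  = inj₁ (i , vᵢ)
... | false = inj₂ (i , cong₂ _xor_ uᵢ≡true vᵢ)

Zero-⊕ : ∀ {n} {u : Word n} → Zero u → (v : Word n) → u ⊕ v ≗ v
Zero-⊕ u≡0 v i = cong (_xor v i) (u≡0 i)

Zero-++ : ∀ p {q} (w : Word (p + q)) → Zero (take p w) → Zero (drop p w) → Zero w
Zero-++ p w take≡0 drop≡0 j with splitAt p j in split
... | inj₁ i = subst (λ k → w k ≡ false) (splitAt⁻¹-↑ˡ split) (take≡0 i)
... | inj₂ i = subst (λ k → w k ≡ false) (splitAt⁻¹-↑ʳ split) (drop≡0 i)

tail-++ : ∀ {A : Set} {p q} (xs : Vector A (suc p)) (ys : Vector A q) →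
          tail (xs ++ ys) ≗ tail xs ++ ys
tail-++ {p = p} xs ys i with splitAt p i
... | inj₁ _ = refl
... | inj₂ _ = refl

map-++ : ∀ {A B : Set} {p q} (f : A → B) (xs : Vector A p) (ys : Vector A q) →
         f ∘ (xs ++ ys) ≗ (f ∘ xs) ++ (f ∘ ys)
map-++ {p = p} f xs ys i with splitAt p i
... | inj₁ _ = refl
... | inj₂ _ = refl

wt-cong : ∀ {n} {u v : Word n} → u ≗ v → wt u ≡ wt v
wt-cong {zero}  u≗v = refl
wt-cong {suc n} u≗v = cong₂ _+_ (cong bit (u≗v zero)) (wt-cong (u≗v ∘ suc))

wt-++ : ∀ {p q} (u : Word p) (v : Word q) → wt (u ++ v) ≡ wt u + wt v
wt-++ {zero}  u v = refl
wt-++ {suc p} u v = begin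
  bit (u zero) + wt (tail (u ++ v))    ≡⟨ cong (bit (u zero) +_) (wt-cong (tail-++ u v)) ⟩
  bit (u zero) + wt (tail u ++ v)      ≡⟨ cong (bit (u zero) +_) (wt-++ (tail u) v) ⟩
  bit (u zero) + (wt (tail u) + wt v)  ≡⟨ +-assoc (bit (u zero)) _ _ ⟨
  wt u + wt v                          ∎
  where open ≡-Reasoning

wt-Zero : ∀ {n} {w : Word n} → Zero w → wt w ≡ 0
wt-Zero {zero}  w≡0 = refl
wt-Zero {suc n} w≡0 = cong₂ _+_ (cong bit (w≡0 zero)) (wt-Zero (w≡0 ∘ suc))

bit-complement : ∀ b → bit b + bit (not b) ≡ 1
bit-complement true  = refl
bit-complement false = refl

wt-complement : ∀ {n} (w : Word n) → wt w + wt (not ∘ w) ≡ n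
wt-complement {zero}  w = refl
wt-complement {suc n} w = begin
  (bit (w zero) + wt (tail w)) + (bit (not (w zero)) + wt (not ∘ tail w))
    ≡⟨ +-interchange (bit (w zero)) (wt (tail w)) (bit (not (w zero))) (wt (not ∘ tail w)) ⟩
  (bit (w zero) + bit (not (w zero))) + (wt (tail w) + wt (not ∘ tail w))
    ≡⟨ cong₂ _+_ (bit-complement (w zero)) (wt-complement (tail w)) ⟩
  suc n ∎
  where open ≡-Reasoning

bit-⊆ : ∀ u c → (u ≡ true → c ≡ true) → bit c ≡ bit u + bit (c xor u)
bit-⊆ true  true  _   = refl
bit-⊆ true  false u⇒c with u⇒c refl
... | ()
bit-⊆ false true  _   = refl
bit-⊆ false false _   = refl

wt-⊆ : ∀ {n} (u c : Word n) → (∀ i → u i ≡ true → c i ≡ true) → wt c ≡ wt u + wt (c ⊕ u)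
wt-⊆ {zero}  u c u⊆c = refl
wt-⊆ {suc n} u c u⊆c = begin
  bit (c zero) + wt (tail c)
    ≡⟨ cong₂ _+_ (bit-⊆ (u zero) (c zero) (u⊆c zero)) (wt-⊆ (tail u) (tail c) (u⊆c ∘ suc)) ⟩
  (bit (u zero) + bit (c zero xor u zero)) + (wt (tail u) + wt (tail c ⊕ tail u))
    ≡⟨ +-interchange (bit (u zero)) (bit (c zero xor u zero)) (wt (tail u)) (wt (tail c ⊕ tail u)) ⟩
  wt u + wt (c ⊕ u) ∎
  where open ≡-Reasoning

dot : ∀ {n} → Word n → Word n → Bool
dot {zero}  a x = false
dot {suc n} a x = (a zero ∧ x zero) xor dot (tail a) (tail x)

dot-congʳ : ∀ {n} (a : Word n) {x x′ : Word n} → x ≗ x′ → dot a x ≡ dot a x′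
dot-congʳ {zero}  a x≗x′ = refl
dot-congʳ {suc n} a x≗x′ = cong₂ _xor_ (cong (a zero ∧_) (x≗x′ zero)) (dot-congʳ (tail a) (x≗x′ ∘ suc))

dot-congˡ : ∀ {n} {a a′ : Word n} → a ≗ a′ → (x : Word n) → dot a x ≡ dot a′ x
dot-congˡ {zero}  a≗a′ x = refl
dot-congˡ {suc n} a≗a′ x = cong₂ _xor_ (cong (_∧ x zero) (a≗a′ zero)) (dot-congˡ (a≗a′ ∘ suc) (tail x))

dot-zeroʳ : ∀ {n} (a : Word n) → dot a zeroW ≡ false
dot-zeroʳ {zero}  a = refl
dot-zeroʳ {suc n} a = cong₂ _xor_ (∧-zeroʳ (a zero)) (dot-zeroʳ (tail a))

dot-Zeroˡ : ∀ {n} {a : Word n} → Zero a → (x : Word n) → dot a x ≡ false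
dot-Zeroˡ {zero}  a≡0 x = refl
dot-Zeroˡ {suc n} a≡0 x = cong₂ _xor_ (cong (_∧ x zero) (a≡0 zero)) (dot-Zeroˡ (a≡0 ∘ suc) (tail x))

dot-⊕ˡ : ∀ {n} (a b x : Word n) → dot (a ⊕ b) x ≡ dot a x xor dot b x
dot-⊕ˡ {zero}  a b x = refl
dot-⊕ˡ {suc n} a b x = begin
  ((a zero xor b zero) ∧ x zero) xor dot (tail a ⊕ tail b) (tail x)
    ≡⟨ cong₂ _xor_ (∧-distribʳ-xor (x zero) (a zero) (b zero)) (dot-⊕ˡ (tail a) (tail b) (tail x)) ⟩
  ((a zero ∧ x zero) xor (b zero ∧ x zero)) xor (dot (tail a) (tail x) xor dot (tail b) (tail x))
    ≡⟨ xor-interchange (a zero ∧ x zero) (b zero ∧ x zero) (dot (tail a) (tail x)) (dot (tail b) (tail x)) ⟩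
  dot a x xor dot b x ∎
  where open ≡-Reasoning

dot-++ : ∀ {p q} (a : Word (p + q)) (x : Word p) (y : Word q) →
         dot a (x ++ y) ≡ dot (take p a) x xor dot (drop p a) y
dot-++ {zero}  a x y = refl
dot-++ {suc p} a x y = begin
  (a zero ∧ x zero) xor dot (tail a) (tail (x ++ y))
    ≡⟨ cong ((a zero ∧ x zero) xor_) (dot-congʳ (tail a) (tail-++ x y)) ⟩
  (a zero ∧ x zero) xor dot (tail a) (tail x ++ y)
    ≡⟨ cong ((a zero ∧ x zero) xor_) (dot-++ (tail a) (tail x) y) ⟩
  (a zero ∧ x zero) xor (dot (take p (tail a)) (tail x) xor dot (drop p (tail a)) y)
    ≡⟨ xor-assoc (a zero ∧ x zero) _ _ ⟨
  dot (take (suc p) a) x xor dot (drop (suc p) a) y ∎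
  where open ≡-Reasoning

encode : ∀ {k n} → Vector (Word k) n → Word k → Word n
encode cols a i = dot a (cols i)

lincomb-transpose : ∀ {k n} (cols : Vector (Word k) n) (a : Word k) →
                    lincomb (transpose cols) a ≗ encode cols a
lincomb-transpose {zero}  cols a i = refl
lincomb-transpose {suc k} cols a i =
  cong ((a zero ∧ cols i zero) xor_) (lincomb-transpose (tail ∘ cols) (tail a) i)

lincomb-⊕ : ∀ {k n} (G : Fin k → Word n) (a b : Word k) →
            lincomb G (a ⊕ b) ≗ lincomb G a ⊕ lincomb G b
lincomb-⊕ G a b i = begin
  lincomb G (a ⊕ b) i                          ≡⟨ lincomb-transpose (transpose G) (a ⊕ b) i ⟩
  dot (a ⊕ b) (λ j → G j i)                    ≡⟨ dot-⊕ˡ a b (λ j → G j i) ⟩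
  dot a (λ j → G j i) xor dot b (λ j → G j i)  ≡⟨ cong₂ _xor_ (lincomb-transpose (transpose G) a i)
                                                               (lincomb-transpose (transpose G) b i) ⟨
  lincomb G a i xor lincomb G b i              ∎
  where open ≡-Reasoning

lincomb-Zero : ∀ {k n} (G : Fin k → Word n) {a : Word k} → Zero a → Zero (lincomb G a)
lincomb-Zero G a≡0 i = trans (lincomb-transpose (transpose G) _ i) (dot-Zeroˡ a≡0 _)

wt-encode-Zero : ∀ {k n} (cols : Vector (Word k) n) {a : Word k} → Zero a → wt (encode cols a) ≡ 0
wt-encode-Zero cols a≡0 = wt-Zero (λ i → dot-Zeroˡ a≡0 (cols i))

wt-encode-++ : ∀ {k p q} (xs : Vector (Word k) p) (ys : Vector (Word k) q) (a : Word k) →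
               wt (encode (xs ++ ys) a) ≡ wt (encode xs a) + wt (encode ys a)
wt-encode-++ xs ys a = trans (wt-cong (map-++ (dot a) xs ys)) (wt-++ (encode xs a) (encode ys a))

wmax<2wmin⇒Minimal : ∀ {k n} (G : Fin k → Word n) {lo hi : ℕ} → hi < lo + lo →
                     (∀ a → NonZero (lincomb G a) → lo ≤ wt (lincomb G a)) →
                     (∀ a → wt (lincomb G a) ≤ hi) → Minimal G
wmax<2wmin⇒Minimal G {lo} {hi} hi<2lo lo≤wt wt≤hi a b _ u≢0 (u⊆c , i , cᵢ≡true , uᵢ≡false) =
  <⇒≱ hi<2lo (begin
    lo + lo                         ≤⟨ +-mono-≤ (lo≤wt b u≢0) (lo≤wt (a ⊕ b) c⊕u≢0) ⟩
    wt u + wt (lincomb G (a ⊕ b))   ≡⟨ cong (wt u +_) (wt-cong (lincomb-⊕ G a b)) ⟩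
    wt u + wt (c ⊕ u)               ≡⟨ wt-⊆ u c u⊆c ⟨
    wt c                            ≤⟨ wt≤hi a ⟩
    hi                              ∎)
  where
  open ≤-Reasoning
  c u : Word _
  c = lincomb G a
  u = lincomb G b
  c⊕u≢0 : NonZero (lincomb G (a ⊕ b))
  c⊕u≢0 = i , trans (lincomb-⊕ G a b i) (cong₂ _xor_ cᵢ≡true uᵢ≡false)

N : ℕ → ℕ
N zero    = 0
N (suc t) = N t + suc (N t)

suc-N≡2^ : ∀ t → suc (N t) ≡ 2 ^ t
suc-N≡2^ zero    = refl
suc-N≡2^ (suc t) = cong₂ _+_ (suc-N≡2^ t) (trans (suc-N≡2^ t) (sym (+-identityʳ (2 ^ t))))

simplexColumns : ∀ t → Vector (Word t) (N t)
allWords : ∀ t → Vector (Word t) (suc (N t))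
simplexColumns zero    ()
simplexColumns (suc t) = ((false ∷_) ∘ simplexColumns t) ++ ((true ∷_) ∘ allWords t)
allWords t = zeroW ∷ simplexColumns t

wt-encode-allWords : ∀ t (a : Word t) →
                     wt (encode (allWords t) a) ≡ wt (encode (simplexColumns t) a)
wt-encode-allWords t a = cong (λ b → bit b + wt (encode (simplexColumns t) a)) (dot-zeroʳ a)

wt-encode-simplex-suc : ∀ t (a : Word (suc t)) {b} → a zero ≡ b →
  wt (encode (simplexColumns (suc t)) a) ≡
  wt (encode (simplexColumns t) (tail a)) + wt ((b xor_) ∘ encode (allWords t) (tail a))
wt-encode-simplex-suc t a refl = begin
  wt (encode (simplexColumns (suc t)) a)
    ≡⟨ wt-encode-++ ((false ∷_) ∘ simplexColumns t) ((true ∷_) ∘ allWords t) a ⟩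
  wt (encode ((false ∷_) ∘ simplexColumns t) a) + wt (encode ((true ∷_) ∘ allWords t) a)
    ≡⟨ cong₂ _+_ (wt-cong (λ i → cong (_xor encode (simplexColumns t) (tail a) i) (∧-zeroʳ (a zero))))
                 (wt-cong (λ i → cong (_xor encode (allWords t) (tail a) i) (∧-identityʳ (a zero)))) ⟩
  wt (encode (simplexColumns t) (tail a)) + wt ((a zero xor_) ∘ encode (allWords t) (tail a)) ∎
  where open ≡-Reasoning

wt-encode-simplex : ∀ s (a : Word (suc s)) → NonZero a → wt (encode (simplexColumns (suc s)) a) ≡ 2 ^ s
wt-encode-simplex s a = by-head (a zero) refl
  where
  open ≡-Reasoning
  a′ : Word s
  a′ = tail a
  e : Word (suc (N s))
  e = encode (allWords s) a′
  twice : ∀ t (b : Word t) → NonZero b →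
          wt (encode (simplexColumns t) b) + wt (encode (simplexColumns t) b) ≡ 2 ^ t
  twice (suc r) b b≢0 = cong₂ _+_ IH (trans IH (sym (+-identityʳ (2 ^ r))))
    where IH = wt-encode-simplex r b b≢0
  by-head : ∀ b → a zero ≡ b → NonZero a → wt (encode (simplexColumns (suc s)) a) ≡ 2 ^ s
  by-head true a₀ _ = begin
    wt (encode (simplexColumns (suc s)) a)            ≡⟨ wt-encode-simplex-suc s a a₀ ⟩
    wt (encode (simplexColumns s) a′) + wt (not ∘ e)  ≡⟨ cong (_+ wt (not ∘ e)) (wt-encode-allWords s a′) ⟨
    wt e + wt (not ∘ e)                               ≡⟨ wt-complement e ⟩
    suc (N s)                                         ≡⟨ suc-N≡2^ s ⟩
    2 ^ s                                             ∎
  by-head false a₀ (zero , a₀≡true) = contradiction (trans (sym a₀) a₀≡true) λ ()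
  by-head false a₀ (suc i , aᵢ≡true) = begin
    wt (encode (simplexColumns (suc s)) a)
      ≡⟨ wt-encode-simplex-suc s a a₀ ⟩
    wt (encode (simplexColumns s) a′) + wt e
      ≡⟨ cong (wt (encode (simplexColumns s) a′) +_) (wt-encode-allWords s a′) ⟩
    wt (encode (simplexColumns s) a′) + wt (encode (simplexColumns s) a′)
      ≡⟨ twice s a′ (i , aᵢ≡true) ⟩
    2 ^ s ∎

module Doubling {t m : ℕ} (cols : Vector (Word t) m) (H : ℕ) (H>0 : 0 < H)
                (one-weight : ∀ a → NonZero a → wt (encode cols a) ≡ H) where

  W : Word t → ℕ
  W a = wt (encode cols a)

  W≡0⊎W≡H : ∀ a → W a ≡ 0 ⊎ W a ≡ H
  W≡0⊎W≡H a with zero-or-nonZero a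
  ... | inj₁ a≡0 = inj₁ (wt-encode-Zero cols a≡0)
  ... | inj₂ a≢0 = inj₂ (one-weight a a≢0)

  W≡0⇒Zero : ∀ {a} → W a ≡ 0 → Zero a
  W≡0⇒Zero {a} W≡0 with zero-or-nonZero a
  ... | inj₁ a≡0 = a≡0
  ... | inj₂ a≢0 = contradiction (trans (sym (one-weight a a≢0)) W≡0) (>⇒≢ H>0)

  H∣W : ∀ a → H ∣ W a
  H∣W a with W≡0⊎W≡H a
  ... | inj₁ W≡0 = subst (H ∣_) (sym W≡0) (H ∣0)
  ... | inj₂ W≡H = subst (H ∣_) (sym W≡H) ∣-refl

  W≤H : ∀ a → W a ≤ H
  W≤H a with W≡0⊎W≡H a
  ... | inj₁ W≡0 = subst (_≤ H) (sym W≡0) z≤n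
  ... | inj₂ W≡H = subst (_≤ H) (sym W≡H) ≤-refl

  pair : Word t → Word t → Word (2 * t)
  pair u v = u ++ (v ++ λ ())

  firstHalf secondHalf : Word (2 * t) → Word t
  firstHalf  a = take t a
  secondHalf a = take t (drop t a)

  dot-pair : ∀ a u v → dot a (pair u v) ≡ dot (firstHalf a) u xor dot (secondHalf a) v
  dot-pair a u v = trans (dot-++ a u _)
    (cong (dot (firstHalf a) u xor_) (trans (dot-++ (drop t a) v _) (xor-identityʳ _)))

  Zero-halves : ∀ a → Zero (firstHalf a) → Zero (secondHalf a) → Zero a
  Zero-halves a first≡0 second≡0 = Zero-++ t a first≡0 (Zero-++ t (drop t a) second≡0 λ ())

  leftColumns rightColumns diagonalColumns : Vector (Word (2 * t)) m
  leftColumns     i = pair (cols i) zeroW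
  rightColumns    i = pair zeroW (cols i)
  diagonalColumns i = pair (cols i) (cols i)

  G : Fin (2 * t) → Word (m + (m + m))
  G = transpose (leftColumns ++ (rightColumns ++ diagonalColumns))

  wt-codeword : ∀ a → let x = firstHalf a; y = secondHalf a in
                wt (lincomb G a) ≡ W x + (W y + W (x ⊕ y))
  wt-codeword a = begin
    wt (lincomb G a)
      ≡⟨ wt-cong (lincomb-transpose (leftColumns ++ (rightColumns ++ diagonalColumns)) a) ⟩
    wt (encode (leftColumns ++ (rightColumns ++ diagonalColumns)) a)
      ≡⟨ wt-encode-++ leftColumns (rightColumns ++ diagonalColumns) a ⟩
    wt (encode leftColumns a) + wt (encode (rightColumns ++ diagonalColumns) a)
      ≡⟨ cong (wt (encode leftColumns a) +_) (wt-encode-++ rightColumns diagonalColumns a) ⟩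
    wt (encode leftColumns a) + (wt (encode rightColumns a) + wt (encode diagonalColumns a))
      ≡⟨ cong₂ _+_ (wt-cong left) (cong₂ _+_ (wt-cong right) (wt-cong diagonal)) ⟩
    W x + (W y + W (x ⊕ y)) ∎
    where
    open ≡-Reasoning
    x y : Word t
    x = firstHalf a
    y = secondHalf a
    left : encode leftColumns a ≗ encode cols x
    left i = trans (dot-pair a (cols i) zeroW)
                   (trans (cong (dot x (cols i) xor_) (dot-zeroʳ y)) (xor-identityʳ _))
    right : encode rightColumns a ≗ encode cols y
    right i = trans (dot-pair a zeroW (cols i)) (cong (_xor dot y (cols i)) (dot-zeroʳ x))
    diagonal : encode diagonalColumns a ≗ encode cols (x ⊕ y)
    diagonal i = trans (dot-pair a (cols i) (cols i)) (sym (dot-⊕ˡ x y (cols i)))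

  W-pair≥2H : ∀ x y → NonZero x ⊎ NonZero y → H + H ≤ W x + (W y + W (x ⊕ y))
  W-pair≥2H x y (inj₁ x≢0) with nonZero-⊕ {v = y} x≢0
  ... | inj₁ y≢0
      rewrite one-weight x x≢0 | one-weight y y≢0 = +-monoʳ-≤ H (m≤m+n H _)
  ... | inj₂ x⊕y≢0
      rewrite one-weight x x≢0 | one-weight (x ⊕ y) x⊕y≢0 = +-monoʳ-≤ H (m≤n+m H _)
  W-pair≥2H x y (inj₂ y≢0) with zero-or-nonZero x
  ... | inj₂ x≢0 = W-pair≥2H x y (inj₁ x≢0)
  ... | inj₁ x≡0
      rewrite wt-encode-Zero cols x≡0
            | wt-cong (λ i → dot-congˡ (Zero-⊕ x≡0 y) (cols i))
            | one-weight y y≢0 = ≤-refl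

  nonZero-half : ∀ a → NonZero (lincomb G a) → NonZero (firstHalf a) ⊎ NonZero (secondHalf a)
  nonZero-half a (i , cᵢ≡true) with zero-or-nonZero (firstHalf a) | zero-or-nonZero (secondHalf a)
  ... | inj₂ first≢0 | _             = inj₁ first≢0
  ... | inj₁ _       | inj₂ second≢0 = inj₂ second≢0
  ... | inj₁ first≡0 | inj₁ second≡0 =
        contradiction (trans (sym (lincomb-Zero G (Zero-halves a first≡0 second≡0) i)) cᵢ≡true) λ ()

  wt≥2H : ∀ a → NonZero (lincomb G a) → H + H ≤ wt (lincomb G a)
  wt≥2H a c≢0 = subst (H + H ≤_) (sym (wt-codeword a)) (W-pair≥2H _ _ (nonZero-half a c≢0))

  wt≤3H : ∀ a → wt (lincomb G a) ≤ H + (H + H)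
  wt≤3H a = subst (_≤ H + (H + H)) (sym (wt-codeword a)) (+-mono-≤ (W≤H _) (+-mono-≤ (W≤H _) (W≤H _)))

  3H<4H : H + (H + H) < (H + H) + (H + H)
  3H<4H = subst (H + (H + H) <_) (sym (+-assoc H H (H + H))) (m<n+m (H + (H + H)) H>0)

  linIndep : LinIndep G
  linIndep a c≡0 = Zero-halves a (W≡0⇒Zero (m+n≡0⇒m≡0 (W x) sum≡0))
                                 (W≡0⇒Zero (m+n≡0⇒m≡0 (W y) (m+n≡0⇒n≡0 (W x) sum≡0)))
    where
    x y : Word t
    x = firstHalf a
    y = secondHalf a
    sum≡0 : W x + (W y + W (x ⊕ y)) ≡ 0
    sum≡0 = trans (sym (wt-codeword a)) (wt-Zero c≡0)

  divisible : Divisible H G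
  divisible a = subst (H ∣_) (sym (wt-codeword a)) (∣m∣n⇒∣m+n (H∣W _) (∣m∣n⇒∣m+n (H∣W _) (H∣W _)))

  divMinCode : DivMinCode (m + (m + m)) (2 * t) H
  divMinCode = G , linIndep , divisible , wmax<2wmin⇒Minimal G 3H<4H wt≥2H wt≤3H

-- The construction only needs t ≥ 1.
mainTheorem3 : (t : ℕ) → 2 ≤ t →
    Σ ℕ λ n → n ≤ 3 * (2 ^ t ∸ 1) × DivMinCode n (2 * t) (2 ^ (t ∸ 1))
mainTheorem3 (suc s) _ =
  N t + (N t + N t) , ≤-reflexive length≡ ,
  Doubling.divMinCode (simplexColumns t) (2 ^ s) (m^n>0 2 s) (wt-encode-simplex s)
  where
  open ≡-Reasoning
  t = suc s
  length≡ : N t + (N t + N t) ≡ 3 * (2 ^ t ∸ 1)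
  length≡ = begin
    N t + (N t + N t)  ≡⟨ cong (λ k → N t + (N t + k)) (+-identityʳ (N t)) ⟨
    3 * N t            ≡⟨ cong (λ k → 3 * (k ∸ 1)) (suc-N≡2^ t) ⟩
    3 * (2 ^ t ∸ 1)    ∎
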